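{- There is a monotone Boolean circuit computing $T_2(x_1,\dots,x_n)$ with $2n + \sqrt{2n} + O(\sqrt[3]{n})$ gates.
   Context: $T_2(x_1,\dots,x_n)$ (the threshold-2 function) is true iff at least two of $x_1,\dots,x_n$ are true, i.e. the negation of $\mathsf{AtMostOne}(x_1,\dots,x_n)$. A monotone Boolean circuit uses only $\wedge$ and $\vee$ gates of fan-in two (no negations); its size is its number of gates. -}

module Defs where

open import Data.Nat using (ℕ; zero; suc; _+_; _≤ᵇ_)
open import Data.Bool using (Bool; true; false; _∧_; _∨_; if_then_else_)
open import Data.Fin using (Fin; zero; suc)
open import Data.Vec using (Vec; tabulate; lookup; _∷ʳ_)
open import Relation.Binary.PropositionalEquality using (_≡_)

data Op : Set where
  AND OR : Op

apply : Op → Bool → Bool → Bool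
apply AND a b = a ∧ b
apply OR  a b = a ∨ b

-- Wires 0..n-1 are the inputs; each gate adds a new wire whose two
-- arguments are any earlier wires (so sharing / DAG structure is allowed).
data Circuit (n : ℕ) : ℕ → Set where
  inputs : Circuit n n
  gate   : ∀ {m} → Circuit n m → Op → Fin m → Fin m → Circuit n (suc m)

size : ∀ {n m} → Circuit n m → ℕ
size inputs           = 0
size (gate c _ _ _)   = suc (size c)

wires : ∀ {n m} → Circuit n m → (Fin n → Bool) → Vec Bool m
wires inputs x = tabulate x
wires (gate c o i j) x =
  let w = wires c x in w ∷ʳ apply o (lookup w i) (lookup w j)

Computes : ∀ {n m} → Circuit n m → Fin m → ((Fin n → Bool) → Bool) → Set
Computes {n} c out f = (x : Fin n → Bool) → lookup (wires c x) out ≡ f x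

countTrue : ∀ {n} → (Fin n → Bool) → ℕ
countTrue {zero}  x = 0
countTrue {suc n} x = (if x zero then 1 else 0) + countTrue (λ i → x (suc i))

T2 : ∀ {n} → (Fin n → Bool) → Bool
T2 x = 2 ≤ᵇ countTrue x

module Submission where

-- Identify the n inputs with distinct edges of a complete P-partite graph whose parts are
-- r × q grids of vertices, every edge going from a lower to a higher part.  One edge touches
-- two vertices in two different parts, while two edges touch three parts or two vertices of
-- one part, and two vertices of one part differ in their row or in their column.  So T₂ is
-- "three parts are touched" OR "in some part two rows or two columns are touched", computed
-- from the ORs over the vertices of the edges incident to them.
-- Those vertex ORs cost 2n minus the number of touched vertices, which pays for the row ORs;
-- the column ORs cost at most P r q ≈ √(2n), and the threshold counters O(P (r + q)).
-- With P, r ≈ n^{1/6} the graph has just enough edges and every error term is O(n^{1/3}).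

open import Defs
open import Data.Nat
  using (ℕ; zero; suc; _+_; _*_; _∸_; _≤_; _<_; _≤ᵇ_; _≤?_; z≤n; s≤s; s≤s⁻¹; NonZero)
open import Data.Nat.Properties
  using ( ≤-refl; ≤-reflexive; ≤-trans; <-≤-trans; ≤-<-trans; <⇒≤; <⇒≱; ≰⇒>
        ; m≤n⇒m≤1+n; n≤1+n; n<1+n; m≤m+n; m+n≤o⇒m≤o; m∸n≤m; ≤ᵇ⇒≤; ≤⇒≤ᵇ
        ; +-comm; +-assoc; +-suc; +-identityʳ; +-cancelʳ-≡; +-mono-≤; +-monoˡ-≤; +-monoʳ-≤
        ; *-comm; *-assoc; *-suc; *-identityˡ; *-identityʳ; *-zeroʳ
        ; *-mono-≤; *-monoˡ-≤; *-monoʳ-≤; *-mono-<; *-monoʳ-<; *-cancelˡ-≤; *-cancelˡ-<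
        ; +-*-semiring; module ≤-Reasoning)
open import Data.Nat.Tactic.RingSolver using (solve-∀)
open import Data.Bool using (Bool; true; false; T; _∧_; _∨_; if_then_else_)
open import Data.Bool.Properties using (∨-identityʳ; ∨-zeroʳ; ∧-identityʳ; ∧-zeroʳ; T-∧; T-∨)
open import Data.Fin using (Fin; zero; suc; _≟_; inject₁; inject≤; fromℕ; splitAt; remQuot)
  renaming (_<_ to _<ᶠ_)
open import Data.Fin.Properties
  using ( inject₁-injective; inject≤-injective; fromℕ≢inject₁; toℕ-inject₁; toℕ-fromℕ; toℕ<n
        ; +↔⊎; *↔×)
  renaming (<⇒≢ to <ᶠ⇒≢; <-trans to <ᶠ-trans)
open import Data.Vec using (Vec; []; _∷_; lookup; _∷ʳ_)
open import Data.Vec.Properties using (lookup∘tabulate)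
open import Data.Vec.Functional using (updateAt)
open import Data.Vec.Functional.Properties using (updateAt-updates; updateAt-minimal)
open import Data.Product using (Σ; ∃-syntax; ∃₂; _×_; _,_; proj₁; proj₂; map₂)
open import Data.Product.Properties using (,-injective)
open import Data.Sum using (_⊎_; inj₁; inj₂; [_,_]′) renaming (map to map-⊎)
open import Data.Unit using (tt)
open import Data.Empty using (⊥; ⊥-elim)
open import Function using (_∘_; _⇔_; mk⇔; Equivalence; Injective; Injection)
open import Function.Properties.Inverse using (↔⇒↣)
open import Relation.Nullary using (Dec; does; yes; no)
open import Relation.Nullary.Decidable using (map′; _×-dec_)
open import Relation.Binary.Definitions using (DecidableEquality)
open import Relation.Binary.PropositionalEquality
open import Algebra.Properties.Semiring.Sum +-*-semiring
  using (sum-syntax; sum-cong-≗; sum-replicate-zero; ∑-distrib-+; ∑-comm; *-distribˡ-sum)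

open Equivalence using (to; from)

𝟙 : Bool → ℕ
𝟙 b = if b then 1 else 0

atLeast : ∀ {k} → ℕ → (Fin k → Bool) → Bool
atLeast t v = t ≤ᵇ countTrue v

countTrue≡∑ : ∀ {k} (v : Fin k → Bool) → countTrue v ≡ ∑[ i < k ] 𝟙 (v i)
countTrue≡∑ {zero}  v = refl
countTrue≡∑ {suc k} v = cong (𝟙 (v zero) +_) (countTrue≡∑ (v ∘ suc))

countTrue≤ : ∀ {k} (v : Fin k → Bool) → countTrue v ≤ k
countTrue≤ {zero}  v = z≤n
countTrue≤ {suc k} v with v zero
... | true  = s≤s (countTrue≤ (v ∘ suc))
... | false = m≤n⇒m≤1+n (countTrue≤ (v ∘ suc))

countTrue-true : ∀ k → countTrue {k} (λ _ → true) ≡ k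
countTrue-true zero    = refl
countTrue-true (suc k) = cong suc (countTrue-true k)

countTrue>0⇒∃ : ∀ {k} (v : Fin k → Bool) → 0 < countTrue v → ∃[ i ] T (v i)
countTrue>0⇒∃ {suc k} v pos with v zero in eq
... | true  = zero , subst T (sym eq) tt
... | false = let i , vi = countTrue>0⇒∃ (v ∘ suc) pos in suc i , vi

_without_ : ∀ {k} → (Fin k → Bool) → Fin k → Fin k → Bool
v without i = updateAt v i (λ _ → false)

T-without : ∀ {k} (v : Fin k → Bool) i j → T ((v without i) j) ⇔ (i ≢ j × T (v j))
T-without v i j with i ≟ j
... | yes refl = mk⇔ (λ h → ⊥-elim (subst T (updateAt-updates i v) h)) (λ (i≢i , _) → ⊥-elim (i≢i refl))
... | no  i≢j  = mk⇔ (λ h → i≢j , subst T (updateAt-minimal j i v (i≢j ∘ sym)) h)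
                     (λ (_ , vj) → subst T (sym (updateAt-minimal j i v (i≢j ∘ sym))) vj)

countTrue-without : ∀ {k} (v : Fin k → Bool) i → T (v i) → countTrue v ≡ suc (countTrue (v without i))
countTrue-without v zero vi with v zero
... | true = refl
countTrue-without v (suc i) vi =
  trans (cong (𝟙 (v zero) +_) (countTrue-without (v ∘ suc) i vi)) (+-suc (𝟙 (v zero)) _)

atLeast-suc⇔ : ∀ {k} t (v : Fin k → Bool) →
  T (atLeast (suc t) v) ⇔ (∃[ i ] T (v i) × T (atLeast t (v without i)))
atLeast-suc⇔ t v = mk⇔
  (λ h → let t<c    = ≤ᵇ⇒≤ (suc t) (countTrue v) h
             i , vi = countTrue>0⇒∃ v (<-≤-trans (s≤s z≤n) t<c)
         in i , vi , ≤⇒≤ᵇ (s≤s⁻¹ (subst (suc t ≤_) (countTrue-without v i vi) t<c)))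
  (λ (i , vi , h) → ≤⇒≤ᵇ (subst (suc t ≤_) (sym (countTrue-without v i vi)) (s≤s (≤ᵇ⇒≤ t _ h))))

atLeast-1⇔ : ∀ {k} (v : Fin k → Bool) → T (atLeast 1 v) ⇔ (∃[ i ] T (v i))
atLeast-1⇔ v = mk⇔
  (λ h → let i , vi , _ = to (atLeast-suc⇔ 0 v) h in i , vi)
  (λ (i , vi) → from (atLeast-suc⇔ 0 v) (i , vi , tt))

atLeast-2⇔ : ∀ {k} (v : Fin k → Bool) → T (atLeast 2 v) ⇔ (∃₂ λ i j → i ≢ j × T (v i) × T (v j))
atLeast-2⇔ v = mk⇔
  (λ h → let i , vi , h′ = to (atLeast-suc⇔ 1 v) h
             j , v∖ij    = to (atLeast-1⇔ (v without i)) h′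
             i≢j , vj    = to (T-without v i j) v∖ij
         in i , j , i≢j , vi , vj)
  (λ (i , j , i≢j , vi , vj) →
     from (atLeast-suc⇔ 1 v) (i , vi , from (atLeast-1⇔ (v without i)) (j , from (T-without v i j) (i≢j , vj))))

atLeast-3⇔ : ∀ {k} (v : Fin k → Bool) →
  T (atLeast 3 v) ⇔ (∃₂ λ i j → ∃[ l ] i ≢ j × i ≢ l × j ≢ l × T (v i) × T (v j) × T (v l))
atLeast-3⇔ v = mk⇔
  (λ h → let i , vi , h′                = to (atLeast-suc⇔ 2 v) h
             j , l , j≢l , v∖ij , v∖il  = to (atLeast-2⇔ (v without i)) h′
             i≢j , vj                   = to (T-without v i j) v∖ij
             i≢l , vl                   = to (T-without v i l) v∖il
         in i , j , l , i≢j , i≢l , j≢l , vi , vj , vl)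
  (λ (i , j , l , i≢j , i≢l , j≢l , vi , vj , vl) →
     from (atLeast-suc⇔ 2 v) (i , vi , from (atLeast-2⇔ (v without i))
       (j , l , j≢l , from (T-without v i j) (i≢j , vj) , from (T-without v i l) (i≢l , vl))))

suc≤ᵇsuc : ∀ t c → (suc t ≤ᵇ suc c) ≡ (t ≤ᵇ c)
suc≤ᵇsuc zero    c = refl
suc≤ᵇsuc (suc t) c = refl

≤ᵇ-absorb : ∀ t c → (t ≤ᵇ c) ≡ (suc t ≤ᵇ c) ∨ (t ≤ᵇ c)
≤ᵇ-absorb zero    c       = sym (∨-zeroʳ _)
≤ᵇ-absorb (suc t) zero    = refl
≤ᵇ-absorb (suc t) (suc c) rewrite suc≤ᵇsuc t c | suc≤ᵇsuc (suc t) c = ≤ᵇ-absorb t c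

atLeast-suc : ∀ {k} t (v : Fin (suc k) → Bool) →
  atLeast (suc t) v ≡ atLeast (suc t) (v ∘ suc) ∨ (v zero ∧ atLeast t (v ∘ suc))
atLeast-suc t v with v zero
... | true  = trans (suc≤ᵇsuc t _) (≤ᵇ-absorb t _)
... | false = sym (∨-identityʳ _)

atLeast-1-suc : ∀ {k} (v : Fin (suc k) → Bool) → atLeast 1 v ≡ v zero ∨ atLeast 1 (v ∘ suc)
atLeast-1-suc v with v zero
... | true  = refl
... | false = refl

T-does : ∀ {p} {P : Set p} (d : Dec P) → T (does d) ⇔ P
T-does (yes p) = mk⇔ (λ _ → p) (λ _ → tt)
T-does (no ¬p) = mk⇔ (λ ()) (λ p → ¬p p)

T-injective : ∀ {a b} → T a ⇔ T b → a ≡ b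
T-injective {false} {false} _   = refl
T-injective {false} {true}  a⇔b = ⊥-elim (from a⇔b tt)
T-injective {true}  {false} a⇔b = ⊥-elim (to a⇔b tt)
T-injective {true}  {true}  _   = refl

∑-mono : ∀ {N} {f g : Fin N → ℕ} → (∀ i → f i ≤ g i) → ∑[ i < N ] f i ≤ ∑[ i < N ] g i
∑-mono {zero}  f≤g = z≤n
∑-mono {suc N} f≤g = +-mono-≤ (f≤g zero) (∑-mono (f≤g ∘ suc))

∑-const : ∀ N c → ∑[ i < N ] c ≡ N * c
∑-const zero    c = refl
∑-const (suc N) c = cong (c +_) (∑-const N c)

∑-δ : ∀ {N} (a : Fin N) (g : Fin N → ℕ) → ∑[ u < N ] (𝟙 (does (a ≟ u)) * g u) ≡ g a
∑-δ {suc N} zero    g = trans (cong₂ _+_ (*-identityˡ (g zero)) (sum-replicate-zero N)) (+-identityʳ (g zero))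
∑-δ {suc N} (suc a) g = ∑-δ a (g ∘ suc)

∑-𝟙δ : ∀ {N} (a : Fin N) → ∑[ u < N ] 𝟙 (does (a ≟ u)) ≡ 1
∑-𝟙δ {N} a = trans (sum-cong-≗ {N} (λ u → sym (*-identityʳ (𝟙 (does (a ≟ u)))))) (∑-δ a (λ _ → 1))

∑-𝟙∧ : ∀ {N} x (h : Fin N → Bool) → ∑[ i < N ] 𝟙 (x ∧ h i) ≡ 𝟙 x * ∑[ i < N ] 𝟙 (h i)
∑-𝟙∧     true  h = sym (*-identityˡ _)
∑-𝟙∧ {N} false h = sum-replicate-zero N

𝟙-∨ : ∀ x y → 𝟙 (x ∨ y) ≤ 𝟙 x + 𝟙 y
𝟙-∨ true  y = s≤s z≤n
𝟙-∨ false y = ≤-refl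

∸1+𝟙 : ∀ d → d ∸ 1 + 𝟙 (1 ≤ᵇ d) ≡ d
∸1+𝟙 zero    = refl
∸1+𝟙 (suc d) = +-comm d 1

-- OR-ing d j wires costs d j ∸ 1 gates and OR-ing the nonempty results one gate fewer than
-- their number: an OR tree costs less than its number of leaves.
or-tree-cost : ∀ {N} (d : Fin N → ℕ) →
  ∑[ j < N ] (d j ∸ 1) + (countTrue (λ j → 1 ≤ᵇ d j) ∸ 1) ≤ ∑[ j < N ] d j
or-tree-cost {N} d = begin
  ∑[ j < N ] (d j ∸ 1) + (countTrue nonempty ∸ 1)  ≤⟨ +-monoʳ-≤ inner (m∸n≤m _ 1) ⟩
  ∑[ j < N ] (d j ∸ 1) + countTrue nonempty        ≡⟨ cong (inner +_) (countTrue≡∑ nonempty) ⟩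
  ∑[ j < N ] (d j ∸ 1) + ∑[ j < N ] 𝟙 (nonempty j) ≡⟨ sym (∑-distrib-+ (λ j → d j ∸ 1) (𝟙 ∘ nonempty)) ⟩
  ∑[ j < N ] (d j ∸ 1 + 𝟙 (nonempty j))           ≡⟨ sum-cong-≗ {N} (∸1+𝟙 ∘ d) ⟩
  ∑[ j < N ] d j                                   ∎
  where
  open ≤-Reasoning
  nonempty : Fin N → Bool
  nonempty j = 1 ≤ᵇ d j
  inner : ℕ
  inner = ∑[ j < N ] (d j ∸ 1)

-- Monotone circuits grown gate by gate

Fn : ℕ → Set
Fn n = (Fin n → Bool) → Bool

threshold : ∀ {n k} → ℕ → (Fin k → Fn n) → Fn n
threshold t F x = atLeast t (λ i → F i x)

CircuitPred : ℕ → Set₁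
CircuitPred n = ∀ {m} → Circuit n m → Set

module _ where

  private variable
    n m m′ m″ k l : ℕ
    c : Circuit n m
    c′ : Circuit n m′
    c″ : Circuit n m″
    f g : Fn n
    b b′ : Bool
    R S : CircuitPred n

  infix 4 _⊑_

  data _⊑_ (c : Circuit n m) : Circuit n m′ → Set where
    ⊑-refl : c ⊑ c
    ⊑-gate : ∀ {o i j} → c ⊑ c′ → c ⊑ gate c′ o i j

  ⊑-trans : c ⊑ c′ → c′ ⊑ c″ → c ⊑ c″
  ⊑-trans e ⊑-refl     = e
  ⊑-trans e (⊑-gate f) = ⊑-gate (⊑-trans e f)

  inputs-⊑ : (c : Circuit n m) → inputs ⊑ c
  inputs-⊑ inputs         = ⊑-refl
  inputs-⊑ (gate c _ _ _) = ⊑-gate (inputs-⊑ c)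

  lookup-∷ʳ-inject₁ : ∀ {A : Set} (v : Vec A k) a i → lookup (v ∷ʳ a) (inject₁ i) ≡ lookup v i
  lookup-∷ʳ-inject₁ (_ ∷ v) a zero    = refl
  lookup-∷ʳ-inject₁ (_ ∷ v) a (suc i) = lookup-∷ʳ-inject₁ v a i

  lookup-∷ʳ-last : ∀ {A : Set} (v : Vec A k) a → lookup (v ∷ʳ a) (fromℕ k) ≡ a
  lookup-∷ʳ-last []      a = refl
  lookup-∷ʳ-last (_ ∷ v) a = lookup-∷ʳ-last v a

  -- A signal for f is a wire computing f, or nothing if f is constantly false (a monotone
  -- circuit has no wire for that); the index says which, since only wires cost gates.
  data Signal (c : Circuit n m) (f : Fn n) : Bool → Set where
    absent  : (∀ x → f x ≡ false) → Signal c f false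
    present : (w : Fin m) → Computes c w f → Signal c f true

  SomeSignal : Circuit n m → Fn n → Set
  SomeSignal c f = ∃[ b ] Signal c f b

  Signal-cast : (∀ x → f x ≡ g x) → b ≡ b′ → Signal c f b → Signal c g b′
  Signal-cast f≗g refl (absent f≡false) = absent (λ x → trans (sym (f≗g x)) (f≡false x))
  Signal-cast f≗g refl (present w w≡f)  = present w (λ x → trans (w≡f x) (f≗g x))

  SomeSignal-cast : (∀ x → f x ≡ g x) → SomeSignal c f → SomeSignal c g
  SomeSignal-cast f≗g (b , s) = b , Signal-cast f≗g refl s

  weaken : c ⊑ c′ → Signal c f b → Signal c′ f b
  weaken ⊑-refl s = s
  weaken {c′ = gate c′ _ _ _} (⊑-gate e) s with weaken e s
  ... | absent f≡false = absent f≡false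
  ... | present w w≡f  = present (inject₁ w) (λ x → trans (lookup-∷ʳ-inject₁ (wires c′ x) _ w) (w≡f x))

  weaken′ : c ⊑ c′ → SomeSignal c f → SomeSignal c′ f
  weaken′ e (b , s) = b , weaken e s

  input : (c : Circuit n m) (b : Bool) (i : Fin n) → Signal c (λ x → b ∧ x i) b
  input c true  i = weaken (inputs-⊑ c) (present i (λ x → lookup∘tabulate x i))
  input c false i = absent (λ _ → refl)

  Stable : CircuitPred n → Set
  Stable {n} R = ∀ {m m′} {c : Circuit n m} {c′ : Circuit n m′} → c ⊑ c′ → R c → R c′

  record Grow (c : Circuit n m) (k : ℕ) (R : CircuitPred n) : Set where
    constructor grown
    field
      {m⁺}    : ℕ
      circuit : Circuit n m⁺
      extends : c ⊑ circuit
      bounded : size circuit ≤ size c + k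
      result  : R circuit

  return : R c → Grow c 0 R
  return {c = c} r = grown c ⊑-refl (≤-reflexive (sym (+-identityʳ _))) r

  relax : k ≤ l → Grow c k R → Grow c l R
  relax k≤l (grown c′ e bound r) = grown c′ e (≤-trans bound (+-monoʳ-≤ _ k≤l)) r

  map : (∀ {m′} {c′ : Circuit n m′} → c ⊑ c′ → R c′ → S c′) → Grow c k R → Grow c k S
  map f (grown c′ e bound r) = grown c′ e bound (f e r)

  infixl 1 _>>=_
  _>>=_ : Grow c k R → (∀ {m′} {c′ : Circuit n m′} → c ⊑ c′ → R c′ → Grow c′ l S) →
          Grow c (k + l) S
  _>>=_ {c = c} {k = k} {l = l} (grown c′ e bound r) f with f e r
  ... | grown c″ e′ bound′ s = grown c″ (⊑-trans e e′) size-c″ s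
    where
    size-c″ : size c″ ≤ size c + (k + l)
    size-c″ = begin
      size c″            ≤⟨ bound′ ⟩
      size c′ + l        ≤⟨ +-monoˡ-≤ l bound ⟩
      size c + k + l     ≡⟨ +-assoc (size c) k l ⟩
      size c + (k + l)   ∎
      where open ≤-Reasoning

  gate-signal : ∀ {n m} {c : Circuit n m} {f g : Fn n} o {i j} → Computes c i f → Computes c j g →
                Grow c 1 (λ c′ → Signal c′ (λ x → apply o (f x) (g x)) true)
  gate-signal {m = m} {c = c} o {i} {j} i≡f j≡g =
    grown (gate c o i j) (⊑-gate ⊑-refl) (≤-reflexive (+-comm 1 (size c))) (present (fromℕ m) λ x → begin
      lookup (wires c x ∷ʳ _) (fromℕ m)                     ≡⟨ lookup-∷ʳ-last (wires c x) _ ⟩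
      apply o (lookup (wires c x) i) (lookup (wires c x) j) ≡⟨ cong₂ (apply o) (i≡f x) (j≡g x) ⟩
      apply o _ _                                           ∎)
    where open ≡-Reasoning

  infixr 6 _∨ˢ_
  infixr 7 _∧ˢ_

  _∨ˢ_ : Signal c f b → Signal c g b′ →
         Grow c (𝟙 (b ∧ b′)) (λ c′ → Signal c′ (λ x → f x ∨ g x) (b ∨ b′))
  absent f≡false ∨ˢ s              = return (Signal-cast (λ x → cong (_∨ _) (sym (f≡false x))) refl s)
  present w w≡f  ∨ˢ absent g≡false =
    return (present w (λ x → trans (w≡f x) (sym (trans (cong (_ ∨_) (g≡false x)) (∨-identityʳ _)))))
  present _ w≡f  ∨ˢ present _ w′≡g = gate-signal OR w≡f w′≡g

  _∧ˢ_ : Signal c f b → Signal c g b′ →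
         Grow c (𝟙 (b ∧ b′)) (λ c′ → Signal c′ (λ x → f x ∧ g x) (b ∧ b′))
  absent f≡false ∧ˢ _              = return (absent (λ x → cong (_∧ _) (f≡false x)))
  present _ _    ∧ˢ absent g≡false = return (absent (λ x → trans (cong (_ ∧_) (g≡false x)) (∧-zeroʳ _)))
  present _ w≡f  ∧ˢ present _ w′≡g = gate-signal AND w≡f w′≡g

  𝟙≤1 : ∀ b → 𝟙 b ≤ 1
  𝟙≤1 true  = ≤-refl
  𝟙≤1 false = z≤n

  ∨-some : SomeSignal c f → SomeSignal c g → Grow c 1 (λ c′ → SomeSignal c′ (λ x → f x ∨ g x))
  ∨-some (b , s) (b′ , s′) = relax (𝟙≤1 (b ∧ b′)) (map (λ _ r → _ , r) (s ∨ˢ s′))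

  ∧-some : SomeSignal c f → SomeSignal c g → Grow c 1 (λ c′ → SomeSignal c′ (λ x → f x ∧ g x))
  ∧-some (b , s) (b′ , s′) = relax (𝟙≤1 (b ∧ b′)) (map (λ _ r → _ , r) (s ∧ˢ s′))

  ∨∧-some : ∀ {y} → SomeSignal c f → SomeSignal c y → SomeSignal c g →
            Grow c 2 (λ c′ → SomeSignal c′ (λ x → f x ∨ (y x ∧ g x)))
  ∨∧-some a y b = ∧-some y b >>= λ e yb → ∨-some (weaken′ e a) yb

  Thresholds : Circuit n m → (Fin k → Fn n) → Set
  Thresholds c F = SomeSignal c (threshold 1 F) × SomeSignal c (threshold 2 F) × SomeSignal c (threshold 3 F)

  thresholds-step : ∀ {F : Fin (suc k) → Fn n} →
                    SomeSignal c (F zero) → Thresholds c (F ∘ suc) → Grow c 5 (λ c′ → Thresholds c′ F)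
  thresholds-step {F = F} y (a₁ , a₂ , a₃) =
    ∨-some a₁ y                                            >>= λ e₁ a₁′ →
    ∨∧-some (weaken′ e₁ a₂) (weaken′ e₁ y) (weaken′ e₁ a₁) >>= λ e₂ a₂′ →
    let e₁₂ = ⊑-trans e₁ e₂ in
    map (λ e₃ a₃′ → SomeSignal-cast step₀ (weaken′ (⊑-trans e₂ e₃) a₁′)
                  , SomeSignal-cast (step 1) (weaken′ e₃ a₂′)
                  , SomeSignal-cast (step 2) a₃′)
        (∨∧-some (weaken′ e₁₂ a₃) (weaken′ e₁₂ y) (weaken′ e₁₂ a₂))
    where
    step : ∀ t x →
           threshold (suc t) (F ∘ suc) x ∨ (F zero x ∧ threshold t (F ∘ suc) x) ≡ threshold (suc t) F x
    step t x = sym (atLeast-suc t (λ i → F i x))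
    step₀ : ∀ x → threshold 1 (F ∘ suc) x ∨ F zero x ≡ threshold 1 F x
    step₀ x = trans (cong (threshold 1 (F ∘ suc) x ∨_) (sym (∧-identityʳ (F zero x)))) (step 0 x)

  always-false : SomeSignal c (λ _ → false)
  always-false = false , absent (λ _ → refl)

  thresholds : ∀ {F : Fin k → Fn n} → (∀ i → SomeSignal c (F i)) → Grow c (k * 5) (λ c′ → Thresholds c′ F)
  thresholds {k = zero}  _ = return (always-false , always-false , always-false)
  thresholds {k = suc k} {F = F} s = relax (≤-reflexive (+-comm (k * 5) 5))
    (thresholds (s ∘ suc) >>= λ e ts → thresholds-step {F = F} (weaken′ e (s zero)) ts)

  orFold-cost : ∀ b c → (c ∸ 1) + 𝟙 (b ∧ (1 ≤ᵇ c)) ≤ (𝟙 b + c) ∸ 1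
  orFold-cost false c       = ≤-reflexive (+-identityʳ _)
  orFold-cost true  zero    = z≤n
  orFold-cost true  (suc c) = ≤-reflexive (+-comm c 1)

  orFold : ∀ {F : Fin k → Fn n} {β : Fin k → Bool} → (∀ i → Signal c (F i) (β i)) →
           Grow c (countTrue β ∸ 1) (λ c′ → Signal c′ (threshold 1 F) (atLeast 1 β))
  orFold {k = zero}  _ = return (absent (λ _ → refl))
  orFold {k = suc k} {F = F} {β} s = relax (orFold-cost (β zero) (countTrue (β ∘ suc)))
    (orFold (s ∘ suc) >>= λ e r →
     map (λ _ → Signal-cast (λ x → sym (atLeast-1-suc (λ i → F i x))) (sym (atLeast-1-suc β)))
         (weaken e (s zero) ∨ˢ r))

  for : ∀ {K} {R : Fin K → CircuitPred n} (cost : Fin K → ℕ) → (∀ i → Stable (R i)) →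
        (∀ i {m′} {c′ : Circuit n m′} → c ⊑ c′ → Grow c′ (cost i) (R i)) →
        Grow c (∑[ i < K ] cost i) (λ c′ → ∀ i → R i c′)
  for {K = zero}  cost stable body = return (λ ())
  for {K = suc K} cost stable body =
    body zero ⊑-refl >>= λ e r₀ →
    map (λ e′ rs → λ { zero → stable zero e′ r₀ ; (suc i) → rs i })
        (for (cost ∘ suc) (stable ∘ suc) (λ i e′ → body (suc i) (⊑-trans e e′)))

  orFold-some : ∀ {F : Fin k → Fn n} → (∀ i → SomeSignal c (F i)) →
                Grow c k (λ c′ → SomeSignal c′ (threshold 1 F))
  orFold-some s = relax (≤-trans (m∸n≤m _ 1) (countTrue≤ _)) (map (λ _ o → _ , o) (orFold (proj₂ ∘ s)))

  wire-of : ∀ x → SomeSignal c f → T (f x) → ∃[ w ] Computes c w f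
  wire-of x (false , absent f≡false) fx = ⊥-elim (subst T (f≡false x) fx)
  wire-of x (true  , present w w≡f)  _  = w , w≡f

Cell : ℕ → ℕ → Set
Cell r q = Fin r × Fin q

module Grid {r q} (g : Fin r → Fin q → Bool) where

  rowOccupied : Fin r → Bool
  rowOccupied i = atLeast 1 (g i)

  colOccupied : Fin q → Bool
  colOccupied j = atLeast 1 (λ i → g i j)

  TwoCells : Set
  TwoCells = ∃₂ λ (a b : Cell r q) → a ≢ b × T (g (proj₁ a) (proj₂ a)) × T (g (proj₁ b) (proj₂ b))

  two-lines⇔two-cells : T (atLeast 2 rowOccupied ∨ atLeast 2 colOccupied) ⇔ TwoCells
  two-lines⇔two-cells = mk⇔ cells lines
    where
    cells : T (atLeast 2 rowOccupied ∨ atLeast 2 colOccupied) → TwoCells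
    cells h with to T-∨ h
    ... | inj₁ two-rows =
      let i , i′ , i≢i′ , ri , ri′ = to (atLeast-2⇔ rowOccupied) two-rows
          j , gij                  = to (atLeast-1⇔ (g i)) ri
          j′ , gi′j′               = to (atLeast-1⇔ (g i′)) ri′
      in (i , j) , (i′ , j′) , (i≢i′ ∘ cong proj₁) , gij , gi′j′
    ... | inj₂ two-cols =
      let j , j′ , j≢j′ , cj , cj′ = to (atLeast-2⇔ colOccupied) two-cols
          i , gij                  = to (atLeast-1⇔ (λ i → g i j)) cj
          i′ , gi′j′               = to (atLeast-1⇔ (λ i → g i j′)) cj′
      in (i , j) , (i′ , j′) , (j≢j′ ∘ cong proj₂) , gij , gi′j′
    lines : TwoCells → T (atLeast 2 rowOccupied ∨ atLeast 2 colOccupied)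
    lines ((i , j) , (i′ , j′) , a≢b , gij , gi′j′) with i ≟ i′
    ... | no i≢i′ = from T-∨ (inj₁ (from (atLeast-2⇔ rowOccupied)
      (i , i′ , i≢i′ , from (atLeast-1⇔ (g i)) (j , gij) , from (atLeast-1⇔ (g i′)) (j′ , gi′j′))))
    ... | yes refl = from T-∨ (inj₂ (from (atLeast-2⇔ colOccupied)
      (j , j′ , (a≢b ∘ cong (i ,_)) ,
       from (atLeast-1⇔ (λ i → g i j)) (i , gij) , from (atLeast-1⇔ (λ i → g i j′)) (i , gi′j′))))

-- Multipartite graphs of grids

Vertex : ℕ → ℕ → ℕ → Set
Vertex P r q = Fin P × Cell r q

part : ∀ {P r q} → Vertex P r q → Fin P
part = proj₁

Ascending : ∀ {P r q} → Vertex P r q × Vertex P r q → Set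
Ascending (u , v) = part u <ᶠ part v

-- Componentwise, so that `does (u ≟ᵛ v)` computes to a conjunction (used by ∑ᵛ-δ).
_≟ᵛ_ : ∀ {P r q} → DecidableEquality (Vertex P r q)
(k , i , j) ≟ᵛ (k′ , i′ , j′) =
  map′ (λ (k≡k′ , i≡i′ , j≡j′) → cong₂ _,_ k≡k′ (cong₂ _,_ i≡i′ j≡j′))
       (λ { refl → refl , refl , refl })
       (k ≟ k′ ×-dec i ≟ i′ ×-dec j ≟ j′)

∑ᵛ : ∀ {P r q} → (Vertex P r q → ℕ) → ℕ
∑ᵛ {P} {r} {q} f = ∑[ k < P ] ∑[ i < r ] ∑[ j < q ] f (k , i , j)

module _ {P r q : ℕ} where

  ∑ᵛ-cong : ∀ {f g : Vertex P r q → ℕ} → (∀ u → f u ≡ g u) → ∑ᵛ f ≡ ∑ᵛ g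
  ∑ᵛ-cong f≗g = sum-cong-≗ λ k → sum-cong-≗ λ i → sum-cong-≗ λ j → f≗g (k , i , j)

  ∑ᵛ-mono : ∀ {f g : Vertex P r q → ℕ} → (∀ u → f u ≤ g u) → ∑ᵛ f ≤ ∑ᵛ g
  ∑ᵛ-mono f≤g = ∑-mono λ k → ∑-mono λ i → ∑-mono λ j → f≤g (k , i , j)

  ∑ᵛ-distrib-+ : ∀ (f g : Vertex P r q → ℕ) → ∑ᵛ (λ u → f u + g u) ≡ ∑ᵛ f + ∑ᵛ g
  ∑ᵛ-distrib-+ f g =
    trans (sum-cong-≗ {P} λ k →
             trans (sum-cong-≗ {r} λ i → ∑-distrib-+ (λ j → f (k , i , j)) (λ j → g (k , i , j)))
                   (∑-distrib-+ (λ i → ∑[ j < q ] f (k , i , j)) (λ i → ∑[ j < q ] g (k , i , j))))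
          (∑-distrib-+ (λ k → ∑[ i < r ] ∑[ j < q ] f (k , i , j))
                       (λ k → ∑[ i < r ] ∑[ j < q ] g (k , i , j)))

  ∑ᵛ-comm : ∀ {N} (g : Vertex P r q → Fin N → ℕ) →
            ∑ᵛ (λ u → ∑[ e < N ] g u e) ≡ ∑[ e < N ] ∑ᵛ (λ u → g u e)
  ∑ᵛ-comm g =
    trans (sum-cong-≗ {P} λ k → trans (sum-cong-≗ {r} λ i → ∑-comm λ j e → g (k , i , j) e)
                                      (∑-comm λ i e → ∑[ j < q ] g (k , i , j) e))
          (∑-comm λ k e → ∑[ i < r ] ∑[ j < q ] g (k , i , j) e)

  ∑ᵛ-δ : ∀ (v : Vertex P r q) → ∑ᵛ (λ u → 𝟙 (does (v ≟ᵛ u))) ≡ 1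
  ∑ᵛ-δ (a , b , c) = begin
    ∑[ k < P ] ∑[ i < r ] ∑[ j < q ] 𝟙 (does (a ≟ k) ∧ (does (b ≟ i) ∧ does (c ≟ j)))
      ≡⟨ sum-cong-≗ {P} (λ k →
           trans (sum-cong-≗ {r} λ i → ∑-𝟙∧ (does (a ≟ k)) (λ j → does (b ≟ i) ∧ does (c ≟ j)))
                 (sym (*-distribˡ-sum (𝟙 (does (a ≟ k))) (λ i → ∑[ j < q ] 𝟙 (does (b ≟ i) ∧ does (c ≟ j)))))) ⟩
    ∑[ k < P ] (𝟙 (does (a ≟ k)) * ∑[ i < r ] ∑[ j < q ] 𝟙 (does (b ≟ i) ∧ does (c ≟ j)))
      ≡⟨ ∑-δ a _ ⟩
    ∑[ i < r ] ∑[ j < q ] 𝟙 (does (b ≟ i) ∧ does (c ≟ j))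
      ≡⟨ sum-cong-≗ {r} (λ i → ∑-𝟙∧ (does (b ≟ i)) (λ j → does (c ≟ j))) ⟩
    ∑[ i < r ] (𝟙 (does (b ≟ i)) * ∑[ j < q ] 𝟙 (does (c ≟ j)))
      ≡⟨ ∑-δ b _ ⟩
    ∑[ j < q ] 𝟙 (does (c ≟ j))
      ≡⟨ ∑-𝟙δ c ⟩
    1 ∎
    where open ≡-Reasoning

overhead : ℕ → ℕ → ℕ → ℕ
overhead P r q = P * (q * r + (r * 5 + (q * 5 + 1))) + (P * 5 + (P + 1))

module Multipartite {n P r q} (ends : Fin n → Vertex P r q × Vertex P r q) where

  src tgt : Fin n → Vertex P r q
  src = proj₁ ∘ ends
  tgt = proj₂ ∘ ends

  incident : Fin n → Vertex P r q → Bool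
  incident e u = does (src e ≟ᵛ u) ∨ does (tgt e ≟ᵛ u)

  Incident : Fin n → Vertex P r q → Set
  Incident e u = src e ≡ u ⊎ tgt e ≡ u

  active : Vertex P r q → Fn n
  active u x = atLeast 1 (λ e → incident e u ∧ x e)

  rowActive : Fin P → Fin r → Fn n
  rowActive k i = threshold 1 (λ j → active (k , i , j))

  colActive : Fin P → Fin q → Fn n
  colActive k j = threshold 1 (λ i → active (k , i , j))

  partActive : Fin P → Fn n
  partActive k = threshold 1 (rowActive k)

  crowded : Fin P → Fn n
  crowded k x = threshold 2 (rowActive k) x ∨ threshold 2 (colActive k) x

  spec : Fn n
  spec x = threshold 3 partActive x ∨ threshold 1 crowded x

  module _ (x : Fin n → Bool) where

    Active : Vertex P r q → Set
    Active u = T (active u x)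

    active⇔ : ∀ {u} → Active u ⇔ (∃[ e ] T (x e) × Incident e u)
    active⇔ {u} = mk⇔
      (λ h → let e , ie = to (atLeast-1⇔ (λ e → incident e u ∧ x e)) h
                 inc , xe = to T-∧ ie
             in e , xe , map-⊎ (to (T-does (src e ≟ᵛ u))) (to (T-does (tgt e ≟ᵛ u))) (to T-∨ inc))
      (λ (e , xe , inc) → from (atLeast-1⇔ (λ e → incident e u ∧ x e))
         (e , from T-∧ (from T-∨ (map-⊎ (from (T-does (src e ≟ᵛ u))) (from (T-does (tgt e ≟ᵛ u))) inc) , xe)))

    partActive⇔ : ∀ {k} → T (partActive k x) ⇔ (∃₂ λ i j → Active (k , i , j))
    partActive⇔ {k} = mk⇔
      (λ h → let i , ri = to (atLeast-1⇔ (λ i → rowActive k i x)) h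
                 j , aij = to (atLeast-1⇔ (λ j → active (k , i , j) x)) ri
             in i , j , aij)
      (λ (i , j , aij) → from (atLeast-1⇔ (λ i → rowActive k i x))
         (i , from (atLeast-1⇔ (λ j → active (k , i , j) x)) (j , aij)))

    Crowded : Set
    Crowded = ∃₂ λ u v → u ≢ v × part u ≡ part v × Active u × Active v

    Spread : Set
    Spread = ∃₂ λ u v → ∃[ w ] part u ≢ part v × part u ≢ part w × part v ≢ part w ×
                               Active u × Active v × Active w

    crowded⇔ : T (threshold 1 crowded x) ⇔ Crowded
    crowded⇔ = mk⇔
      (λ h → let k , ck = to (atLeast-1⇔ (λ k → crowded k x)) h
                 (i , j) , (i′ , j′) , a≢b , aij , ai′j′ =
                   to (Grid.two-lines⇔two-cells (λ i j → active (k , i , j) x)) ck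
             in (k , i , j) , (k , i′ , j′) , (λ eq → a≢b (cong proj₂ eq)) , refl , aij , ai′j′)
      (λ { ((k , i , j) , (k′ , i′ , j′) , u≢v , refl , aij , ai′j′) →
         from (atLeast-1⇔ (λ k → crowded k x))
           (k , from (Grid.two-lines⇔two-cells (λ i j → active (k , i , j) x))
                  ((i , j) , (i′ , j′) , (λ eq → u≢v (cong (k ,_) eq)) , aij , ai′j′)) })

    spread⇔ : T (threshold 3 partActive x) ⇔ Spread
    spread⇔ = mk⇔
      (λ h → let k₁ , k₂ , k₃ , k₁≢k₂ , k₁≢k₃ , k₂≢k₃ , p₁ , p₂ , p₃ =
                   to (atLeast-3⇔ (λ k → partActive k x)) h
                 i₁ , j₁ , a₁ = to partActive⇔ p₁
                 i₂ , j₂ , a₂ = to partActive⇔ p₂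
                 i₃ , j₃ , a₃ = to partActive⇔ p₃
             in (k₁ , i₁ , j₁) , (k₂ , i₂ , j₂) , (k₃ , i₃ , j₃) , k₁≢k₂ , k₁≢k₃ , k₂≢k₃ , a₁ , a₂ , a₃)
      (λ ((k₁ , i₁ , j₁) , (k₂ , i₂ , j₂) , (k₃ , i₃ , j₃) , k₁≢k₂ , k₁≢k₃ , k₂≢k₃ , a₁ , a₂ , a₃) →
         from (atLeast-3⇔ (λ k → partActive k x))
           (k₁ , k₂ , k₃ , k₁≢k₂ , k₁≢k₃ , k₂≢k₃ ,
            from partActive⇔ (i₁ , j₁ , a₁) , from partActive⇔ (i₂ , j₂ , a₂) , from partActive⇔ (i₃ , j₃ , a₃)))

  degree : Vertex P r q → ℕ
  degree u = countTrue (λ e → incident e u)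

  handshake : ∑ᵛ degree ≤ 2 * n
  handshake = begin
    ∑ᵛ degree                              ≡⟨ ∑ᵛ-cong (λ u → countTrue≡∑ (λ e → incident e u)) ⟩
    ∑ᵛ (λ u → ∑[ e < n ] 𝟙 (incident e u)) ≡⟨ ∑ᵛ-comm (λ u e → 𝟙 (incident e u)) ⟩
    ∑[ e < n ] ∑ᵛ (λ u → 𝟙 (incident e u)) ≤⟨ ∑-mono two-ends ⟩
    ∑[ e < n ] 2                           ≡⟨ ∑-const n 2 ⟩
    n * 2                                  ≡⟨ *-comm n 2 ⟩
    2 * n                                  ∎
    where
    open ≤-Reasoning
    two-ends : ∀ e → ∑ᵛ (λ u → 𝟙 (incident e u)) ≤ 2
    two-ends e = begin
      ∑ᵛ (λ u → 𝟙 (incident e u))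
        ≤⟨ ∑ᵛ-mono (λ u → 𝟙-∨ (does (src e ≟ᵛ u)) (does (tgt e ≟ᵛ u))) ⟩
      ∑ᵛ (λ u → 𝟙 (does (src e ≟ᵛ u)) + 𝟙 (does (tgt e ≟ᵛ u)))
        ≡⟨ ∑ᵛ-distrib-+ (λ u → 𝟙 (does (src e ≟ᵛ u))) (λ u → 𝟙 (does (tgt e ≟ᵛ u))) ⟩
      ∑ᵛ (λ u → 𝟙 (does (src e ≟ᵛ u))) + ∑ᵛ (λ u → 𝟙 (does (tgt e ≟ᵛ u)))
        ≡⟨ cong₂ _+_ (∑ᵛ-δ (src e)) (∑ᵛ-δ (tgt e)) ⟩
      2 ∎

  vertex-signal : ∀ {m} {c : Circuit n m} u →
                  Grow c (degree u ∸ 1) (λ c′ → Signal c′ (active u) (1 ≤ᵇ degree u))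
  vertex-signal {c = c} u = orFold (λ e → input c (incident e u) e)

  RowSignals : Fin P → Fin r → CircuitPred n
  RowSignals k i c =
    (∀ j → Signal c (active (k , i , j)) (1 ≤ᵇ degree (k , i , j))) × SomeSignal c (rowActive k i)

  row-signals : ∀ {m} {c : Circuit n m} k i → Grow c (∑[ j < q ] degree (k , i , j)) (RowSignals k i)
  row-signals k i = relax (or-tree-cost (λ j → degree (k , i , j)))
    (for (λ j → degree (k , i , j) ∸ 1) (λ j → weaken) (λ j _ → vertex-signal (k , i , j)) >>= λ e vertices →
     map (λ e′ row → (λ j → weaken e′ (vertices j)) , (_ , row)) (orFold vertices))

  PartSignals : Fin P → CircuitPred n
  PartSignals k c = SomeSignal c (partActive k) × SomeSignal c (crowded k)

  partDegree : Fin P → ℕ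
  partDegree k = ∑[ i < r ] ∑[ j < q ] degree (k , i , j)

  partCost : ℕ
  partCost = q * r + (r * 5 + (q * 5 + 1))

  part-signals : ∀ {m} {c : Circuit n m} k → Grow c (partDegree k + partCost) (PartSignals k)
  part-signals k =
    for _ (λ i e (vertices , row) → (λ j → weaken e (vertices j)) , weaken′ e row) (λ i _ → row-signals k i)
      >>= λ e₁ rows →
    relax (≤-reflexive (∑-const q r))
      (for (λ _ → r) (λ _ → weaken′) (λ j e → orFold-some (λ i → _ , weaken e (proj₁ (rows i) j))))
      >>= λ e₂ cols →
    thresholds (λ i → weaken′ e₂ (proj₂ (rows i))) >>= λ e₃ (rowsAny , rowsTwo , _) →
    thresholds (λ j → weaken′ e₃ (cols j))          >>= λ e₄ (_ , colsTwo , _) →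
    map (λ e₅ crowd → weaken′ (⊑-trans e₄ e₅) rowsAny , crowd) (∨-some (weaken′ e₄ rowsTwo) colsTwo)

  spec-signal : ∀ {m} {c : Circuit n m} →
                Grow c (∑[ k < P ] (partDegree k + partCost) + (P * 5 + (P + 1))) (λ c′ → SomeSignal c′ spec)
  spec-signal =
    for _ (λ k e (any , crowd) → weaken′ e any , weaken′ e crowd) (λ k _ → part-signals k) >>= λ e₁ parts →
    thresholds (λ k → proj₁ (parts k))               >>= λ e₂ (_ , _ , spread) →
    orFold-some (λ k → weaken′ e₂ (proj₂ (parts k))) >>= λ e₃ crowd →
    ∨-some (weaken′ e₃ spread) crowd

  spec-circuit : Grow (inputs {n}) (2 * n + overhead P r q) (λ c → SomeSignal c spec)
  spec-circuit = relax cost spec-signal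
    where
    cost : ∑[ k < P ] (partDegree k + partCost) + (P * 5 + (P + 1)) ≤ 2 * n + overhead P r q
    cost = begin
      ∑[ k < P ] (partDegree k + partCost) + (P * 5 + (P + 1))
        ≡⟨ cong (_+ (P * 5 + (P + 1))) (∑-distrib-+ partDegree (λ _ → partCost)) ⟩
      ∑ᵛ degree + ∑[ k < P ] partCost + (P * 5 + (P + 1))
        ≤⟨ +-monoˡ-≤ (P * 5 + (P + 1)) (+-mono-≤ handshake (≤-reflexive (∑-const P partCost))) ⟩
      2 * n + P * partCost + (P * 5 + (P + 1))
        ≡⟨ +-assoc (2 * n) (P * partCost) _ ⟩
      2 * n + overhead P r q ∎
      where open ≤-Reasoning

  module _ (ends-injective : Injective _≡_ _≡_ ends) (ends-ascending : ∀ e → Ascending (ends e)) where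

    endpoints-apart : ∀ {e u v} → Incident e u → Incident e v → u ≢ v → part u ≢ part v
    endpoints-apart     (inj₁ refl) (inj₁ refl) u≢v = ⊥-elim (u≢v refl)
    endpoints-apart {e} (inj₁ refl) (inj₂ refl) _   = <ᶠ⇒≢ (ends-ascending e)
    endpoints-apart {e} (inj₂ refl) (inj₁ refl) _   = ≢-sym (<ᶠ⇒≢ (ends-ascending e))
    endpoints-apart     (inj₂ refl) (inj₂ refl) u≢v = ⊥-elim (u≢v refl)

    no-three-parts : ∀ {e u v w} → Incident e u → Incident e v → Incident e w →
                     part u ≢ part v → part u ≢ part w → part v ≢ part w → ⊥
    no-three-parts (inj₁ refl) (inj₁ refl) _           puv _   _   = puv refl
    no-three-parts (inj₁ refl) (inj₂ refl) (inj₁ refl) _   puw _   = puw refl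
    no-three-parts (inj₁ refl) (inj₂ refl) (inj₂ refl) _   _   pvw = pvw refl
    no-three-parts (inj₂ refl) (inj₁ refl) (inj₁ refl) _   _   pvw = pvw refl
    no-three-parts (inj₂ refl) (inj₁ refl) (inj₂ refl) _   puw _   = puw refl
    no-three-parts (inj₂ refl) (inj₂ refl) _           puv _   _   = puv refl

    module _ (x : Fin n → Bool) where

      TwoInputs : Set
      TwoInputs = ∃₂ λ e e′ → e ≢ e′ × T (x e) × T (x e′)

      sound : Spread x ⊎ Crowded x → TwoInputs
      sound (inj₁ (u , v , w , puv , puw , pvw , au , av , aw))
        with to (active⇔ x) au | to (active⇔ x) av | to (active⇔ x) aw
      ... | e₁ , x₁ , i₁ | e₂ , x₂ , i₂ | e₃ , x₃ , i₃ with e₁ ≟ e₂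
      ...   | no e₁≢e₂ = e₁ , e₂ , e₁≢e₂ , x₁ , x₂
      ...   | yes refl with e₁ ≟ e₃
      ...     | no e₁≢e₃ = e₁ , e₃ , e₁≢e₃ , x₁ , x₃
      ...     | yes refl = ⊥-elim (no-three-parts i₁ i₂ i₃ puv puw pvw)
      sound (inj₂ (u , v , u≢v , puv , au , av)) with to (active⇔ x) au | to (active⇔ x) av
      ... | e₁ , x₁ , i₁ | e₂ , x₂ , i₂ with e₁ ≟ e₂
      ...   | no e₁≢e₂ = e₁ , e₂ , e₁≢e₂ , x₁ , x₂
      ...   | yes refl = ⊥-elim (endpoints-apart i₁ i₂ u≢v puv)

      same-part : ∀ {u v} → part u ≡ part v → Active x u → Active x v → u ≡ v ⊎ Crowded x
      same-part {u} {v} puv au av with u ≟ᵛ v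
      ... | yes u≡v = inj₁ u≡v
      ... | no  u≢v = inj₂ (u , v , u≢v , puv , au , av)

      two-pairs : ∀ {a b a′ b′} → part a <ᶠ part b → part a′ <ᶠ part b′ → (a , b) ≢ (a′ , b′) →
                  Active x a → Active x b → Active x a′ → Active x b′ → Spread x ⊎ Crowded x
      two-pairs {a} {b} {a′} {b′} o o′ ne aa ab aa′ ab′ with part a ≟ part a′
      ... | yes paa′ with same-part paa′ aa aa′
      ...   | inj₂ crowd = inj₂ crowd
      ...   | inj₁ refl with part b ≟ part b′
      ...     | no pbb′ = inj₁ (a , b , b′ , <ᶠ⇒≢ o , <ᶠ⇒≢ o′ , pbb′ , aa , ab , ab′)
      ...     | yes pbb′ with same-part pbb′ ab ab′
      ...       | inj₂ crowd = inj₂ crowd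
      ...       | inj₁ refl  = ⊥-elim (ne refl)
      two-pairs {a} {b} {a′} {b′} o o′ ne aa ab aa′ ab′ | no paa′ with part b ≟ part a′
      ... | no pba′ = inj₁ (a , b , a′ , <ᶠ⇒≢ o , paa′ , pba′ , aa , ab , aa′)
      ... | yes pba′ with same-part pba′ ab aa′
      ...   | inj₂ crowd = inj₂ crowd
      ...   | inj₁ refl  = inj₁ (a , b , b′ , <ᶠ⇒≢ o , <ᶠ⇒≢ (<ᶠ-trans o o′) , <ᶠ⇒≢ o′ , aa , ab , ab′)

      complete : TwoInputs → Spread x ⊎ Crowded x
      complete (e , e′ , e≢e′ , xe , xe′) =
        two-pairs (ends-ascending e) (ends-ascending e′) (λ eq → e≢e′ (ends-injective eq))
          (endpoint xe (inj₁ refl)) (endpoint xe (inj₂ refl))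
          (endpoint xe′ (inj₁ refl)) (endpoint xe′ (inj₂ refl))
        where
        endpoint : ∀ {e u} → T (x e) → Incident e u → Active x u
        endpoint {e} xe inc = from (active⇔ x) (e , xe , inc)

    spec≡T2 : ∀ x → spec x ≡ T2 x
    spec≡T2 x = T-injective (mk⇔
      (λ h → from (atLeast-2⇔ x) (sound x (map-⊎ (to (spread⇔ x)) (to (crowded⇔ x)) (to T-∨ h))))
      (λ h → from T-∨ (map-⊎ (from (spread⇔ x)) (from (crowded⇔ x)) (complete x (to (atLeast-2⇔ x) h)))))

    T2-circuit : 2 ≤ n →
      ∃[ m ] Σ (Circuit n m) λ c → Σ (Fin m) λ out → Computes c out T2 × size c ≤ 2 * n + overhead P r q
    T2-circuit 2≤n = _ , circuit , out , (λ x → trans (out≡spec x) (spec≡T2 x)) , bounded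
      where
      open Grow spec-circuit
      all-true : T (spec (λ _ → true))
      all-true = subst T (sym (spec≡T2 (λ _ → true))) (≤⇒≤ᵇ (subst (2 ≤_) (sym (countTrue-true n)) 2≤n))
      wire : ∃[ w ] Computes circuit w spec
      wire = wire-of (λ _ → true) result all-true
      out : Fin m⁺
      out = proj₁ wire
      out≡spec : Computes circuit out spec
      out≡spec = proj₂ wire

-- Labelling the inputs by edges

edgeCount : ℕ → ℕ → ℕ
edgeCount s zero    = 0
edgeCount s (suc t) = edgeCount s t + t * (s * s)

-- That is, edgeCount s t = C(t, 2) s², stated without division.
edgeCount-closed : ∀ s t → 2 * edgeCount s t + t * (s * s) ≡ t * t * (s * s)
edgeCount-closed s zero    = refl
edgeCount-closed s (suc t) = begin
  2 * (e + t * s²) + suc t * s²          ≡⟨ expand e t s² ⟩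
  (2 * e + t * s²) + (2 * (t * s²) + s²) ≡⟨ cong (_+ (2 * (t * s²) + s²)) (edgeCount-closed s t) ⟩
  t * t * s² + (2 * (t * s²) + s²)       ≡⟨ square t s² ⟩
  suc t * suc t * s²                     ∎
  where
  open ≡-Reasoning
  e s² : ℕ
  e  = edgeCount s t
  s² = s * s
  expand : ∀ e t x → 2 * (e + t * x) + suc t * x ≡ (2 * e + t * x) + (2 * (t * x) + x)
  expand = solve-∀
  square : ∀ t x → t * t * x + (2 * (t * x) + x) ≡ suc t * suc t * x
  square = solve-∀

[,]-injective : ∀ {A B C : Set} {f : A → C} {g : B → C} → Injective _≡_ _≡_ f → Injective _≡_ _≡_ g →
                (∀ a b → f a ≢ g b) → Injective _≡_ _≡_ [ f , g ]′
[,]-injective f-inj g-inj apart {inj₁ a} {inj₁ a′} eq = cong inj₁ (f-inj eq)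
[,]-injective f-inj g-inj apart {inj₁ a} {inj₂ b}  eq = ⊥-elim (apart a b eq)
[,]-injective f-inj g-inj apart {inj₂ b} {inj₁ a}  eq = ⊥-elim (apart a b (sym eq))
[,]-injective f-inj g-inj apart {inj₂ b} {inj₂ b′} eq = cong inj₂ (g-inj eq)

remQuot-injective : ∀ {a} b → Injective _≡_ _≡_ (remQuot {a} b)
remQuot-injective b = Injection.injective (↔⇒↣ *↔×)

splitAt-injective : ∀ a {b} → Injective _≡_ _≡_ (splitAt a {b})
splitAt-injective a = Injection.injective (↔⇒↣ +↔⊎)

module _ {r q : ℕ} where

  Edge : ℕ → Set
  Edge t = Vertex t r q × Vertex t r q

  raise : ∀ {t} → Edge t → Edge (suc t)
  raise ((k , a) , (l , b)) = (inject₁ k , a) , (inject₁ l , b)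

  raise-injective : ∀ {t} → Injective _≡_ _≡_ (raise {t})
  raise-injective {x = (k , a) , (l , b)} {(k′ , a′) , (l′ , b′)} eq with ,-injective eq
  ... | eq₁ , eq₂ with ,-injective eq₁ | ,-injective eq₂
  ... | k≡ , refl | l≡ , refl rewrite inject₁-injective k≡ | inject₁-injective l≡ = refl

  to-newest : ∀ {t} → Fin t × Fin (r * q) × Fin (r * q) → Edge (suc t)
  to-newest {t} (k , a , b) = (inject₁ k , remQuot q a) , (fromℕ t , remQuot q b)

  to-newest-injective : ∀ {t} → Injective _≡_ _≡_ (to-newest {t})
  to-newest-injective {x = k , a , b} {k′ , a′ , b′} eq with ,-injective eq
  ... | eq₁ , eq₂ with ,-injective eq₁ | ,-injective eq₂
  ... | k≡ , a≡ | _ , b≡ rewrite inject₁-injective k≡ | remQuot-injective q a≡ | remQuot-injective q b≡ = refl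

  unpair : ∀ {t} → Fin (t * ((r * q) * (r * q))) → Fin t × Fin (r * q) × Fin (r * q)
  unpair f = map₂ (remQuot (r * q)) (remQuot ((r * q) * (r * q)) f)

  unpair-injective : ∀ {t} → Injective _≡_ _≡_ (unpair {t})
  unpair-injective {t} {f} {f′} eq with ,-injective eq
  ... | k≡ , ab≡ = remQuot-injective ((r * q) * (r * q)) (cong₂ _,_ k≡ (remQuot-injective (r * q) ab≡))

  -- First the edges among the first t parts, then those from them into the new part t.
  edge : ∀ t → Fin (edgeCount (r * q) t) → Edge t
  edge zero    ()
  edge (suc t) = [ raise ∘ edge t , to-newest ∘ unpair ]′ ∘ splitAt (edgeCount (r * q) t)

  edge-injective : ∀ t → Injective _≡_ _≡_ (edge t)
  edge-injective zero    {()}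
  edge-injective (suc t) =
    splitAt-injective (edgeCount (r * q) t)
    ∘ [,]-injective (edge-injective t ∘ raise-injective) (unpair-injective ∘ to-newest-injective) apart
    where
    apart : ∀ e f → raise (edge t e) ≢ to-newest (unpair f)
    apart e f eq = fromℕ≢inject₁ (sym (cong (part ∘ proj₂) eq))

  edge-ascending : ∀ t e → Ascending (edge t e)
  edge-ascending zero    ()
  edge-ascending (suc t) e with splitAt (edgeCount (r * q) t) e
  ... | inj₁ e′ rewrite toℕ-inject₁ (part (proj₁ (edge t e′))) | toℕ-inject₁ (part (proj₂ (edge t e′))) =
    edge-ascending t e′
  ... | inj₂ f rewrite toℕ-inject₁ (proj₁ (unpair {t} f)) | toℕ-fromℕ t = toℕ<n (proj₁ (unpair {t} f))

T2-circuit-of-edgeCount : ∀ {n P r q} → 2 ≤ n → n ≤ edgeCount (r * q) P →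
  ∃[ m ] Σ (Circuit n m) λ c → Σ (Fin m) λ out → Computes c out T2 × size c ≤ 2 * n + overhead P r q
T2-circuit-of-edgeCount {n} {P} {r} {q} 2≤n n≤E =
  Multipartite.T2-circuit ends
    (λ {e} {e′} eq → inject≤-injective n≤E n≤E e e′ (edge-injective P eq))
    (λ e → edge-ascending P (inject≤ e n≤E))
    2≤n
  where
  ends : Fin n → Vertex P r q × Vertex P r q
  ends e = edge P (inject≤ e n≤E)

-- Choice of the parameters

bracket : (f : ℕ → ℕ) → f 0 ≡ 0 → (∀ x → f x < f (suc x)) → ∀ N → ∃[ x ] f x ≤ N × N < f (suc x)
bracket f f0≡0 f-< zero = 0 , ≤-reflexive f0≡0 , subst (_< f 1) f0≡0 (f-< 0)
bracket f f0≡0 f-< (suc N) with bracket f f0≡0 f-< N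
... | x , fx≤N , N<fx+1 with f (suc x) ≤? suc N
...   | yes fx+1≤N+1 = suc x , fx+1≤N+1 , ≤-<-trans N<fx+1 (f-< (suc x))
...   | no  fx+1≰N+1 = x , m≤n⇒m≤1+n fx≤N , ≰⇒> fx+1≰N+1

sixth : ℕ → ℕ
sixth x = x * x * (x * x) * (x * x)

cube : ℕ → ℕ
cube x = x * x * x

sixth-< : ∀ x → sixth x < sixth (suc x)
sixth-< x = *-mono-< (*-mono-< x²< x²<) x²<
  where
  x²< : x * x < suc x * suc x
  x²< = *-mono-< (n<1+n x) (n<1+n x)

square-< : ∀ x → x * x < suc x * suc x
square-< x = *-mono-< (n<1+n x) (n<1+n x)

-- a < 2 (m+1)³ because a² ≤ 2n < 2 (m+1)⁶, and 2 (m+1)³ ≤ 8m³ as soon as m ≥ 2.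
root-bound : ∀ k a n → a * a ≤ 2 * n → n < sixth (3 + k) → suc a ≤ 8 * cube (2 + k)
root-bound k a n a²≤2n n<c⁶ = ≤-trans a<2c³ (m+n≤o⇒m≤o _ (≤-reflexive (cube-slack k)))
  where
  c³ : ℕ
  c³ = cube (3 + k)
  a<2c³ : a < 2 * c³
  a<2c³ = ≰⇒> λ 2c³≤a →
    <⇒≱ (<-≤-trans (*-monoʳ-< 2 n<c⁶) (m+n≤o⇒m≤o _ (≤-reflexive (double-sixth (3 + k)))))
        (≤-trans (*-mono-≤ 2c³≤a 2c³≤a) a²≤2n)
    where
    double-sixth : ∀ c → 2 * (c * c * (c * c) * (c * c)) + 2 * (c * c * (c * c) * (c * c))
                         ≡ 2 * (c * c * c) * (2 * (c * c * c))
    double-sixth = solve-∀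
  cube-slack : ∀ k → 2 * ((3 + k) * (3 + k) * (3 + k)) + (6 * k * k * k + 30 * k * k + 42 * k + 10)
                     ≡ 8 * ((2 + k) * (2 + k) * (2 + k))
  cube-slack = solve-∀

-- After multiplying by m + 1, the bound a + 1 ≤ 8m³ gives (m+1)(a+1)² ≤ m (a+1+4m²)².
enough-edges : ∀ m a n q → 2 * n < suc a * suc a → suc a ≤ 8 * cube m → suc a + 4 * (m * m) ≤ m * suc m * q →
               n ≤ edgeCount (m * q) (suc m)
enough-edges m a n q 2n<A² A≤8m³ A+4m²≤X = <⇒≤ (*-cancelˡ-< 2 n E (*-cancelˡ-< (suc m) (2 * n) (2 * E) chain))
  where
  open ≤-Reasoning
  A E X s² : ℕ
  A  = suc a
  E  = edgeCount (m * q) (suc m)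
  X  = m * suc m * q
  s² = (m * q) * (m * q)
  2E≡ : 2 * E ≡ suc m * m * s²
  2E≡ = +-cancelʳ-≡ (suc m * s²) (2 * E) (suc m * m * s²)
          (trans (edgeCount-closed (m * q) (suc m)) (peel m s²))
    where
    peel : ∀ m x → suc m * suc m * x ≡ suc m * m * x + suc m * x
    peel = solve-∀
  chain : suc m * (2 * n) < suc m * (2 * E)
  chain = begin-strict
    suc m * (2 * n)                                  <⟨ *-monoʳ-< (suc m) 2n<A² ⟩
    suc m * (A * A)                                  ≡⟨ split m A ⟩
    m * (A * A) + A * A                              ≤⟨ +-monoʳ-≤ (m * (A * A)) (*-monoˡ-≤ A A≤8m³) ⟩
    m * (A * A) + 8 * cube m * A                     ≤⟨ m≤m+n _ _ ⟩
    m * (A * A) + 8 * cube m * A + m * (4 * (m * m) * (4 * (m * m))) ≡⟨ expand m A ⟩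
    m * ((A + 4 * (m * m)) * (A + 4 * (m * m)))      ≤⟨ *-monoʳ-≤ m (*-mono-≤ A+4m²≤X A+4m²≤X) ⟩
    m * (X * X)                                      ≡⟨ regroup m q ⟩
    suc m * (suc m * m * s²)                         ≡⟨ cong (suc m *_) (sym 2E≡) ⟩
    suc m * (2 * E)                                  ∎
    where
    split : ∀ m x → suc m * (x * x) ≡ m * (x * x) + x * x
    split = solve-∀
    expand : ∀ m x → m * (x * x) + 8 * (m * m * m) * x + m * (4 * (m * m) * (4 * (m * m)))
                     ≡ m * ((x + 4 * (m * m)) * (x + 4 * (m * m)))
    expand = solve-∀
    regroup : ∀ m q → m * (m * suc m * q * (m * suc m * q)) ≡ suc m * (suc m * m * ((m * q) * (m * q)))
    regroup = solve-∀

overhead-bound : ∀ m a q .{{_ : NonZero m}} → suc a ≤ 8 * cube m →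
                 m * suc m * q ≤ a + 4 * (m * m) + m * suc m → overhead (suc m) m q ≤ a + 100 * suc (m * m)
overhead-bound m@(suc m′) a q A≤8m³ X≤ = begin
  overhead (suc m) m q
    ≡⟨ expand m q ⟩
  m * suc m * q + 5 * (suc m * q) + (5 * (m * m) + 12 * m + 8)
    ≤⟨ +-monoˡ-≤ (5 * (m * m) + 12 * m + 8) (+-mono-≤ X≤ (*-monoʳ-≤ 5 Y≤)) ⟩
  a + 4 * (m * m) + m * suc m + 5 * (8 * (m * m) + 5 * m + 1) + (5 * (m * m) + 12 * m + 8)
    ≡⟨ collect a m ⟩
  a + (50 * (m * m) + 38 * m + 13)
    ≤⟨ +-monoʳ-≤ a (m+n≤o⇒m≤o _ (≤-reflexive (slack m′))) ⟩
  a + 100 * suc (m * m) ∎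
  where
  open ≤-Reasoning
  expand : ∀ m q → suc m * (q * m + (m * 5 + (q * 5 + 1))) + (suc m * 5 + (suc m + 1))
                   ≡ m * suc m * q + 5 * (suc m * q) + (5 * (m * m) + 12 * m + 8)
  expand = solve-∀
  factor : ∀ m → 8 * (m * m * m) + 4 * (m * m) + m * suc m ≡ m * (8 * (m * m) + 5 * m + 1)
  factor = solve-∀
  Y≤ : suc m * q ≤ 8 * (m * m) + 5 * m + 1
  Y≤ = *-cancelˡ-≤ m (begin
    m * (suc m * q)                         ≡⟨ sym (*-assoc m (suc m) q) ⟩
    m * suc m * q                           ≤⟨ X≤ ⟩
    a + 4 * (m * m) + m * suc m
      ≤⟨ +-monoˡ-≤ (m * suc m) (+-monoˡ-≤ (4 * (m * m)) (≤-trans (n≤1+n a) A≤8m³)) ⟩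
    8 * cube m + 4 * (m * m) + m * suc m    ≡⟨ factor m ⟩
    m * (8 * (m * m) + 5 * m + 1)           ∎)
  collect : ∀ a m → a + 4 * (m * m) + m * suc m + 5 * (8 * (m * m) + 5 * m + 1)
                    + (5 * (m * m) + 12 * m + 8) ≡ a + (50 * (m * m) + 38 * m + 13)
  collect = solve-∀
  slack : ∀ m′ → 50 * (suc m′ * suc m′) + 38 * suc m′ + 13 + (50 * (m′ * m′) + 62 * m′ + 99)
                 ≡ 100 * suc (suc m′ * suc m′)
  slack = solve-∀

-- m = 2 + k = ⌊n^{1/6}⌋ and a = ⌊√(2n)⌋; take m + 1 parts of m rows and q columns,
-- q being least with m (m + 1) q > a + 4m², so that P r q exceeds a by O(m²).
parameters-for : ∀ k n a → n < sixth (3 + k) → a * a ≤ 2 * n → 2 * n < suc a * suc a →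
  ∃[ P ] ∃[ r ] ∃[ q ] (n ≤ edgeCount (r * q) P × overhead P r q ≤ a + 100 * suc ((2 + k) * (2 + k)))
parameters-for k n a n<⟨m+1⟩⁶ a²≤2n 2n<⟨a+1⟩² =
  let q₀ , Dq₀≤ , <Dq = bracket (D *_) (*-zeroʳ D) (λ x → *-monoʳ-< D (n<1+n x)) (a + 4 * (m * m))
  in suc m , m , suc q₀ , enough-edges m a n (suc q₀) 2n<⟨a+1⟩² a+1≤8m³ <Dq ,
     overhead-bound m a (suc q₀) a+1≤8m³ (Dq≤ q₀ Dq₀≤)
  where
  m D : ℕ
  m = 2 + k
  D = m * suc m
  a+1≤8m³ : suc a ≤ 8 * cube m
  a+1≤8m³ = root-bound k a n a²≤2n n<⟨m+1⟩⁶
  Dq≤ : ∀ q₀ → D * q₀ ≤ a + 4 * (m * m) → D * suc q₀ ≤ a + 4 * (m * m) + D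
  Dq≤ q₀ Dq₀≤ = begin
    D * suc q₀                ≡⟨ *-suc D q₀ ⟩
    D + D * q₀                ≤⟨ +-monoʳ-≤ D Dq₀≤ ⟩
    D + (a + 4 * (m * m))     ≡⟨ +-comm D _ ⟩
    a + 4 * (m * m) + D       ∎
    where open ≤-Reasoning

parameters : ∀ n → 64 ≤ n → ∃[ P ] ∃[ r ] ∃[ q ] ∃[ a ] ∃[ b ]
  (a * a ≤ 2 * n × b * b * b ≤ n × n ≤ edgeCount (r * q) P × overhead P r q ≤ a + 100 * suc b)
parameters n 64≤n with bracket sixth refl sixth-< n | bracket (λ a → a * a) refl square-< (2 * n)
... | 0 , _ , n<1 | _ = ⊥-elim (<⇒≱ n<1 (≤-trans (s≤s z≤n) 64≤n))
... | 1 , _ , n<64 | _ = ⊥-elim (<⇒≱ n<64 64≤n)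
... | suc (suc k) , m⁶≤n , n<⟨m+1⟩⁶ | a , a²≤2n , 2n<⟨a+1⟩² =
  let P , r , q , n≤E , overhead≤ = parameters-for k n a n<⟨m+1⟩⁶ a²≤2n 2n<⟨a+1⟩²
  in P , r , q , a , (2 + k) * (2 + k) , a²≤2n , m⁶≤n , n≤E , overhead≤

T2-circuit-for-large-n : ∀ n → 64 ≤ n →
  ∃[ m ] Σ (Circuit n m) λ c → Σ (Fin m) λ out → Computes c out T2 ×
    ∃[ a ] ∃[ b ] (a * a ≤ 2 * n × b * b * b ≤ n × size c ≤ 2 * n + a + 100 * suc b)
T2-circuit-for-large-n n 64≤n with parameters n 64≤n
... | P , r , q , a , b , a²≤2n , b³≤n , n≤E , overhead≤ =
  bound-size (T2-circuit-of-edgeCount {n} {P} {r} {q} (≤-trans (s≤s (s≤s z≤n)) 64≤n) n≤E)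
  where
  -- A helper rather than `with`: abstracting over the circuit term would make Agda normalise it.
  bound-size : (∃[ m ] Σ (Circuit n m) λ c → Σ (Fin m) λ out →
                  Computes c out T2 × size c ≤ 2 * n + overhead P r q) →
    ∃[ m ] Σ (Circuit n m) λ c → Σ (Fin m) λ out → Computes c out T2 ×
      ∃[ a ] ∃[ b ] (a * a ≤ 2 * n × b * b * b ≤ n × size c ≤ 2 * n + a + 100 * suc b)
  bound-size (m , c , out , computes , size≤) = m , c , out , computes , a , b , a²≤2n , b³≤n ,
    ≤-trans size≤ (≤-trans (+-monoʳ-≤ (2 * n) overhead≤) (≤-reflexive (sym (+-assoc (2 * n) a (100 * suc b)))))

theorem9 : ∃[ C ] ∃[ N₀ ] ((n : ℕ) → N₀ ≤ n →
    ∃[ m ] Σ (Circuit n m) λ c → Σ (Fin m) λ out →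
      Computes c out T2 ×
      ∃[ a ] ∃[ b ] (a * a ≤ 2 * n × b * b * b ≤ n ×
        size c ≤ 2 * n + a + C * suc b))
theorem9 = 100 , 64 , T2-circuit-for-large-n
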